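{- Let $M$ be a $\lambda$-term. If $M$ is $\beta$-normalizable, then there exists $a\in T_r(M)$ such that $NF(a)$ is a positive rigid term.
   Context: Rigid resource terms: $a ::= x\mid \lambda x.a\mid \langle c\rangle\vec d\mid 0$, $\vec d=(d_1,\dots,d_n)$ a finite list of rigid terms; up to $\alpha$; $0$ absorbing ($\lambda x.0=0$, $\langle0\rangle\vec d=0$, a list containing $0$ equals $0$). Rigid substitution $a[\vec b/x]$, $\vec b=(b_1,\dots,b_k)$: if $x$ has exactly $k$ free occurrences in $a$, replace the $i$-th (left-to-right) by $b_i$; else $0$. Rigid reduction $\to_r$: contextual closure of $\langle\lambda x.a\rangle\vec b\to_r a[\vec b/x]$; confluent and strongly normalizing, $NF(a)$ is the unique normal form (a rigid term or $0$). Rigid expansion: $T_r(x)=\{x\}$, $T_r(\lambda x.M)=\{\lambda x.a\mid a\in T_r(M)\}$, $T_r(PQ)=\{\langle c\rangle(d_1,\dots,d_n)\mid c\in T_r(P), n\ge0, d_i\in T_r(Q)\}$. Positive rigid terms: $x$; $\lambda x.a$ with $a$ positive; $\langle c\rangle(d_1,\dots,d_n)$ with $n\ge1$ and $c,d_i$ positive ($0$ is not positive). -}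

module Defs where

open import Data.Nat using (ℕ; zero; suc; _+_; _<ᵇ_; _≡ᵇ_; pred)
open import Data.Bool using (if_then_else_)
open import Data.List using (List; []; _∷_)
open import Data.List.Relation.Unary.All using (All)
open import Data.Maybe using (Maybe; just; nothing)
open import Data.Product using (Σ; _×_; _,_)
open import Relation.Nullary using (¬_)

-- Pure λ-terms (de Bruijn indices; free variables are indices that
-- escape all binders) and β-reduction.

data Tm : Set where
  var : ℕ → Tm
  lam : Tm → Tm
  app : Tm → Tm → Tm

shift : ℕ → ℕ → Tm → Tm
shift c d (var n) = if n <ᵇ c then var n else var (n + d)
shift c d (lam t) = lam (shift (suc c) d t)
shift c d (app t u) = app (shift c d t) (shift c d u)

inst : ℕ → Tm → Tm → Tm
inst k u (var n) = if n <ᵇ k then var n else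
                   (if n ≡ᵇ k then shift 0 k u else var (pred n))
inst k u (lam t) = lam (inst (suc k) u t)
inst k u (app t s) = app (inst k u t) (inst k u s)

data _→β_ : Tm → Tm → Set where
  beta : ∀ {t u} → app (lam t) u →β inst 0 u t
  ξlam : ∀ {t t'} → t →β t' → lam t →β lam t'
  ξappL : ∀ {t t' u} → t →β t' → app t u →β app t' u
  ξappR : ∀ {t u u'} → u →β u' → app t u →β app t u'

data _→β*_ : Tm → Tm → Set where
  β-refl : ∀ {t} → t →β* t
  β-step : ∀ {t u v} → t →β u → u →β* v → t →β* v

BetaNormal : Tm → Set
BetaNormal t = ∀ u → ¬ (t →β u)

BetaNormalizable : Tm → Set
BetaNormalizable t = Σ Tm λ u → (t →β* u) × BetaNormal u

-- The absorbing term 0 is not a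
-- constructor: a "rigid term or 0" is an element of Maybe RTm, with
-- nothing standing for 0 (this realises the absorption laws
-- λx.0 = 0, ⟨0⟩d = 0, lists containing 0 equal 0).

data RTm : Set where
  rvar : ℕ → RTm
  rlam : RTm → RTm
  rapp : RTm → List RTm → RTm

mutual
  rshift : ℕ → ℕ → RTm → RTm
  rshift c d (rvar n) = if n <ᵇ c then rvar n else rvar (n + d)
  rshift c d (rlam a) = rlam (rshift (suc c) d a)
  rshift c d (rapp a ds) = rapp (rshift c d a) (rshifts c d ds)

  rshifts : ℕ → ℕ → List RTm → List RTm
  rshifts c d [] = []
  rshifts c d (a ∷ as) = rshift c d a ∷ rshifts c d as

-- Rigid substitution helper: rsub k a bs replaces, left to right, the
-- occurrences of the variable bound at depth k in a by the successive
-- elements of bs, returning the result and the unused elements;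
-- nothing if bs runs out.
mutual
  rsub : ℕ → RTm → List RTm → Maybe (RTm × List RTm)
  rsub k (rvar n) bs = if n <ᵇ k then just (rvar n , bs) else
                       (if n ≡ᵇ k then pop k bs else just (rvar (pred n) , bs))
  rsub k (rlam a) bs = lamR (rsub (suc k) a bs)
  rsub k (rapp c ds) bs = appR k ds (rsub k c bs)

  rsubs : ℕ → List RTm → List RTm → Maybe (List RTm × List RTm)
  rsubs k [] bs = just ([] , bs)
  rsubs k (d ∷ ds) bs = consR k ds (rsub k d bs)

  appR : ℕ → List RTm → Maybe (RTm × List RTm) → Maybe (RTm × List RTm)
  appR k ds nothing = nothing
  appR k ds (just (c' , r)) = appR₂ c' (rsubs k ds r)

  consR : ℕ → List RTm → Maybe (RTm × List RTm) → Maybe (List RTm × List RTm)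
  consR k ds nothing = nothing
  consR k ds (just (d' , r)) = consR₂ d' (rsubs k ds r)

  pop : ℕ → List RTm → Maybe (RTm × List RTm)
  pop k [] = nothing
  pop k (b ∷ bs) = just (rshift 0 k b , bs)

  lamR : Maybe (RTm × List RTm) → Maybe (RTm × List RTm)
  lamR nothing = nothing
  lamR (just (a , r)) = just (rlam a , r)

  appR₂ : RTm → Maybe (List RTm × List RTm) → Maybe (RTm × List RTm)
  appR₂ c nothing = nothing
  appR₂ c (just (ds , r)) = just (rapp c ds , r)

  consR₂ : RTm → Maybe (List RTm × List RTm) → Maybe (List RTm × List RTm)
  consR₂ d nothing = nothing
  consR₂ d (just (ds , r)) = just (d ∷ ds , r)

finish : Maybe (RTm × List RTm) → Maybe RTm
finish nothing = nothing
finish (just (a , [])) = just a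
finish (just (a , _ ∷ _)) = nothing

-- a[bs/x] where x is the variable bound by the λ of the redex
-- (0 unless the number of occurrences equals the length of bs)
rsubst : RTm → List RTm → Maybe RTm
rsubst a bs = finish (rsub 0 a bs)

mapM : {A B : Set} → (A → B) → Maybe A → Maybe B
mapM f nothing = nothing
mapM f (just x) = just (f x)

mutual
  data _⇒r_ : RTm → Maybe RTm → Set where
    rbeta : ∀ {a bs} → rapp (rlam a) bs ⇒r rsubst a bs
    rξlam : ∀ {a m} → a ⇒r m → rlam a ⇒r mapM rlam m
    rξappL : ∀ {c ds m} → c ⇒r m → rapp c ds ⇒r mapM (λ c' → rapp c' ds) m
    rξappR : ∀ {c ds m} → ds ⇒rs m → rapp c ds ⇒r mapM (rapp c) m

  data _⇒rs_ : List RTm → Maybe (List RTm) → Set where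
    here : ∀ {d ds m} → d ⇒r m → (d ∷ ds) ⇒rs mapM (λ d' → d' ∷ ds) m
    there : ∀ {d ds m} → ds ⇒rs m → (d ∷ ds) ⇒rs mapM (λ ds' → d ∷ ds') m

data _⇒r*_ : Maybe RTm → Maybe RTm → Set where
  r-refl : ∀ {m} → m ⇒r* m
  r-step : ∀ {a m n} → a ⇒r m → m ⇒r* n → just a ⇒r* n

RigidNormal : RTm → Set
RigidNormal a = ∀ m → ¬ (a ⇒r m)

-- NF(a) = b  (b a nonzero rigid term): a reduces to b and b is normal.
-- (By confluence and strong normalisation this determines NF(a).)
NFis : RTm → RTm → Set
NFis a b = (just a ⇒r* just b) × RigidNormal b

data _∈Tr_ : RTm → Tm → Set where
  tvar : ∀ {n} → rvar n ∈Tr var n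
  tlam : ∀ {a M} → a ∈Tr M → rlam a ∈Tr lam M
  tapp : ∀ {c ds P Q} → c ∈Tr P → All (λ d → d ∈Tr Q) ds → rapp c ds ∈Tr app P Q

data Positive : RTm → Set where
  pvar : ∀ {n} → Positive (rvar n)
  plam : ∀ {a} → Positive a → Positive (rlam a)
  papp : ∀ {c d ds} → Positive c → All Positive (d ∷ ds) → Positive (rapp c (d ∷ ds))

module Submission where

-- Normal forms are handled by the *linear* expansion of a term,
-- in which every application carries exactly one argument: it lies in
-- T_r(N), is positive, and is rigid-normal as soon as N is β-normal
-- (a rigid redex in it would be the image of a β-redex of N).  Along
-- the reduction M →β* N we then transport such an element backwards
-- by *subject expansion*: if M →β M' and a' ∈ T_r(M') then some
-- a ∈ T_r(M) rigidly reduces to a'.  For a root redex (λx.P)Q this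
-- rests on a decomposition lemma: every element of T_r(P[Q/x]) is a
-- rigid substitution p[b⃗/x] with p ∈ T_r(P) and b⃗ a list from T_r(Q),
-- so ⟨λx.p⟩b⃗ ∈ T_r((λx.P)Q) reduces to it in one step; the contextual
-- cases are handled by lifting reduction sequences through contexts.

open import Defs
open import Data.Bool using (true; false; if_then_else_)
open import Data.Nat using (ℕ; suc; _<ᵇ_; _≡ᵇ_; _+_; pred)
open import Data.List using (List; []; _∷_; _++_)
open import Data.List.Properties using (++-assoc; ++-identityʳ)
open import Data.List.Relation.Unary.All using (All; []; _∷_)
open import Data.List.Relation.Unary.All.Properties using (++⁺)
open import Data.Maybe using (just; nothing)
open import Data.Product using (Σ; _×_; _,_)
open import Relation.Binary.PropositionalEquality
  using (_≡_; refl; sym; trans; cong; cong₂; subst)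

if-true : ∀ {A : Set} b (x y : A) → b ≡ true → (if b then x else y) ≡ x
if-true .true x y refl = refl

if-false : ∀ {A : Set} b (x y : A) → b ≡ false → (if b then x else y) ≡ y
if-false .false x y refl = refl

-- Every element of T_r(shift c d Q) is the shift of an element of
-- T_r(Q): expansion commutes with renaming.  Needed because the
-- substitution inst k Q P inserts shifted copies of Q.
mutual
  unshift-∈Tr : ∀ c d Q a → a ∈Tr shift c d Q →
    Σ RTm λ b → b ∈Tr Q × rshift c d b ≡ a
  unshift-∈Tr c d (var n) a h with n <ᵇ c in below
  unshift-∈Tr c d (var n) .(rvar n) tvar | true =
    rvar n , tvar , if-true _ _ _ below
  unshift-∈Tr c d (var n) .(rvar (n + d)) tvar | false =
    rvar n , tvar , if-false _ _ _ below
  unshift-∈Tr c d (lam Q) (rlam a) (tlam h) with unshift-∈Tr (suc c) d Q a h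
  ... | b , b∈ , eq = rlam b , tlam b∈ , cong rlam eq
  unshift-∈Tr c d (app P Q) (rapp a ds) (tapp h hs)
    with unshift-∈Tr c d P a h | unshifts-∈Tr c d Q ds hs
  ... | b , b∈ , eq | bs , bs∈ , eqs = rapp b bs , tapp b∈ bs∈ , cong₂ rapp eq eqs

  unshifts-∈Tr : ∀ c d Q ds → All (λ a → a ∈Tr shift c d Q) ds →
    Σ (List RTm) λ bs → All (λ b → b ∈Tr Q) bs × rshifts c d bs ≡ ds
  unshifts-∈Tr c d Q [] [] = [] , [] , refl
  unshifts-∈Tr c d Q (a ∷ ds) (h ∷ hs)
    with unshift-∈Tr c d Q a h | unshifts-∈Tr c d Q ds hs
  ... | b , b∈ , eq | bs , bs∈ , eqs = b ∷ bs , b∈ ∷ bs∈ , cong₂ _∷_ eq eqs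

SubstitutesTo : ℕ → RTm → List RTm → RTm → Set
SubstitutesTo k p bs a = ∀ rest → rsub k p (bs ++ rest) ≡ just (a , rest)

SubstitutesTos : ℕ → List RTm → List RTm → List RTm → Set
SubstitutesTos k ps bs as = ∀ rest → rsubs k ps (bs ++ rest) ≡ just (as , rest)

-- The substituted lists of the subterms are concatenated left to
-- right, matching the left-to-right order of rigid substitution.
record Decomposition (k : ℕ) (Q P : Tm) (a : RTm) : Set where
  constructor decomposition
  field
    skeleton    : RTm
    skeleton∈   : skeleton ∈Tr P
    arguments   : List RTm
    arguments∈  : All (λ b → b ∈Tr Q) arguments
    substitutes : SubstitutesTo k skeleton arguments a

record Decompositions (k : ℕ) (Q P : Tm) (as : List RTm) : Set where
  constructor decompositions
  field
    skeletons   : List RTm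
    skeletons∈  : All (λ p → p ∈Tr P) skeletons
    arguments   : List RTm
    arguments∈  : All (λ b → b ∈Tr Q) arguments
    substitutes : SubstitutesTos k skeletons arguments as

mutual
  decompose : ∀ k Q P a → a ∈Tr inst k Q P → Decomposition k Q P a
  decompose k Q (var n) a h with n <ᵇ k in below
  decompose k Q (var n) .(rvar n) tvar | true =
    decomposition (rvar n) tvar [] [] λ rest → if-true _ _ _ below
  ... | false with n ≡ᵇ k in hit
  ...   | true with unshift-∈Tr 0 k Q a h
  ...     | b , b∈ , eq = decomposition (rvar n) tvar (b ∷ []) (b∈ ∷ []) λ rest →
    trans (if-false _ _ _ below)
      (trans (if-true _ _ _ hit) (cong (λ x → just (x , rest)) eq))
  decompose k Q (var n) .(rvar (pred n)) tvar | false | false =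
    decomposition (rvar n) tvar [] [] λ rest →
      trans (if-false _ _ _ below) (if-false _ _ _ hit)
  decompose k Q (lam P) (rlam a) (tlam h) with decompose (suc k) Q P a h
  ... | decomposition p p∈ bs bs∈ sub =
    decomposition (rlam p) (tlam p∈) bs bs∈ λ rest → cong lamR (sub rest)
  decompose k Q (app P P') (rapp a ds) (tapp h hs)
    with decompose k Q P a h | decomposes k Q P' ds hs
  ... | decomposition p p∈ bs bs∈ sub | decompositions ps ps∈ bs' bs'∈ subs =
    decomposition (rapp p ps) (tapp p∈ ps∈) (bs ++ bs') (++⁺ bs∈ bs'∈) λ rest →
      trans (cong (λ l → appR k ps (rsub k p l)) (++-assoc bs bs' rest))
        (trans (cong (appR k ps) (sub (bs' ++ rest))) (cong (appR₂ a) (subs rest)))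

  decomposes : ∀ k Q P ds → All (λ a → a ∈Tr inst k Q P) ds → Decompositions k Q P ds
  decomposes k Q P [] [] = decompositions [] [] [] [] λ rest → refl
  decomposes k Q P (d ∷ ds) (h ∷ hs) with decompose k Q P d h | decomposes k Q P ds hs
  ... | decomposition p p∈ bs bs∈ sub | decompositions ps ps∈ bs' bs'∈ subs =
    decompositions (p ∷ ps) (p∈ ∷ ps∈) (bs ++ bs') (++⁺ bs∈ bs'∈) λ rest →
      trans (cong (λ l → consR k ps (rsub k p l)) (++-assoc bs bs' rest))
        (trans (cong (consR k ps) (sub (bs' ++ rest))) (cong (consR₂ d) (subs rest)))

decomposition-step : ∀ {p bs a} → SubstitutesTo 0 p bs a → rapp (rlam p) bs ⇒r just a
decomposition-step {p} {bs} sub = subst (rapp (rlam p) bs ⇒r_) p[bs]≡a rbeta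
  where
  p[bs]≡a : rsubst p bs ≡ just _
  p[bs]≡a = cong finish (trans (cong (rsub 0 p) (sym (++-identityʳ bs))) (sub []))

_⇒r*-trans_ : ∀ {a b c} → a ⇒r* b → b ⇒r* c → a ⇒r* c
r-refl ⇒r*-trans q = q
r-step s p ⇒r*-trans q = r-step s (p ⇒r*-trans q)

Compatible : (RTm → RTm) → Set
Compatible F = ∀ {a m} → a ⇒r m → F a ⇒r mapM F m

CompatibleList : (List RTm → RTm) → Set
CompatibleList G = ∀ {l m} → l ⇒rs m → G l ⇒r mapM G m

compatible* : ∀ {F} → Compatible F → ∀ {m b} → m ⇒r* just b → mapM F m ⇒r* just (F b)
compatible* F-step r-refl = r-refl
compatible* F-step (r-step {m = just _} s r) = r-step (F-step s) (compatible* F-step r)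

head-compatible : ∀ {G} → CompatibleList G → ∀ es → Compatible (λ x → G (x ∷ es))
head-compatible G-step es {m = nothing} s = G-step (here s)
head-compatible G-step es {m = just _} s = G-step (here s)

tail-compatible : ∀ {G} → CompatibleList G → ∀ d → CompatibleList (λ l → G (d ∷ l))
tail-compatible G-step d {m = nothing} s = G-step (there s)
tail-compatible G-step d {m = just _} s = G-step (there s)

expand-arguments : ∀ {Q Q'} →
  (∀ d → d ∈Tr Q' → Σ RTm λ e → e ∈Tr Q × just e ⇒r* just d) →
  ∀ ds → All (λ d → d ∈Tr Q') ds →
  Σ (List RTm) λ es → All (λ e → e ∈Tr Q) es ×
    (∀ {G} → CompatibleList G → just (G es) ⇒r* just (G ds))
expand-arguments expand [] [] = [] , [] , λ _ → r-refl
expand-arguments expand (d ∷ ds) (h ∷ hs)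
  with expand d h | expand-arguments expand ds hs
... | e , e∈ , e⇒d | es , es∈ , es⇒ds = e ∷ es , e∈ ∷ es∈ , λ G-step →
  compatible* (head-compatible G-step es) e⇒d
    ⇒r*-trans es⇒ds (tail-compatible G-step d)

subject-expansion : ∀ {M M'} → M →β M' →
  ∀ a' → a' ∈Tr M' → Σ RTm λ a → a ∈Tr M × just a ⇒r* just a'
subject-expansion (beta {P} {Q}) a' h with decompose 0 Q P a' h
... | decomposition p p∈ bs bs∈ sub =
  rapp (rlam p) bs , tapp (tlam p∈) bs∈ , r-step (decomposition-step sub) r-refl
subject-expansion (ξlam s) (rlam a') (tlam h) with subject-expansion s a' h
... | a , a∈ , a⇒a' = rlam a , tlam a∈ , compatible* rξlam a⇒a'
subject-expansion (ξappL s) (rapp c ds) (tapp h hs) with subject-expansion s c h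
... | a , a∈ , a⇒c = rapp a ds , tapp a∈ hs , compatible* rξappL a⇒c
subject-expansion (ξappR s) (rapp c ds) (tapp h hs)
  with expand-arguments (subject-expansion s) ds hs
... | es , es∈ , es⇒ds = rapp c es , tapp h es∈ , es⇒ds rξappR

linear : Tm → RTm
linear (var n) = rvar n
linear (lam t) = rlam (linear t)
linear (app t u) = rapp (linear t) (linear u ∷ [])

linear-∈Tr : ∀ t → linear t ∈Tr t
linear-∈Tr (var n) = tvar
linear-∈Tr (lam t) = tlam (linear-∈Tr t)
linear-∈Tr (app t u) = tapp (linear-∈Tr t) (linear-∈Tr u ∷ [])

linear-positive : ∀ t → Positive (linear t)
linear-positive (var n) = pvar
linear-positive (lam t) = plam (linear-positive t)
linear-positive (app t u) = papp (linear-positive t) (linear-positive u ∷ [])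

mutual
  linear-step-reflects : ∀ t {m} → linear t ⇒r m → Σ Tm (t →β_)
  linear-step-reflects (var n) ()
  linear-step-reflects (lam t) (rξlam s) with linear-step-reflects t s
  ... | t' , t→t' = lam t' , ξlam t→t'
  linear-step-reflects (app t u) s = linear-app-step-reflects t u s

  linear-app-step-reflects : ∀ t u {m} →
    rapp (linear t) (linear u ∷ []) ⇒r m → Σ Tm (app t u →β_)
  linear-app-step-reflects (lam t) u rbeta = _ , beta
  linear-app-step-reflects t u (rξappL s) with linear-step-reflects t s
  ... | t' , t→t' = app t' u , ξappL t→t'
  linear-app-step-reflects t u (rξappR (here s)) with linear-step-reflects u s
  ... | u' , u→u' = app t u' , ξappR u→u'
  linear-app-step-reflects t u (rξappR (there ()))

linear-normal : ∀ {N} → BetaNormal N → RigidNormal (linear N)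
linear-normal {N} N-normal m s with linear-step-reflects N s
... | N' , N→N' = N-normal N' N→N'

HasPositiveNF : Tm → Set
HasPositiveNF M = Σ RTm (λ a → (a ∈Tr M) × Σ RTm (λ b → NFis a b × Positive b))

normal-has-positive-nf : ∀ {N} → BetaNormal N → HasPositiveNF N
normal-has-positive-nf {N} N-normal =
  linear N , linear-∈Tr N , linear N , (r-refl , linear-normal N-normal) , linear-positive N

positive-nf-backward : ∀ {M N} → M →β* N → HasPositiveNF N → HasPositiveNF M
positive-nf-backward β-refl hasNF = hasNF
positive-nf-backward (β-step s r) hasNF with positive-nf-backward r hasNF
... | a' , a'∈ , b , (a'⇒b , b-normal) , b-positive with subject-expansion s a' a'∈
... | a , a∈ , a⇒a' = a , a∈ , b , (a⇒a' ⇒r*-trans a'⇒b , b-normal) , b-positive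

mainTheorem6 : (M : Tm) → BetaNormalizable M →
    Σ RTm (λ a → (a ∈Tr M) × Σ RTm (λ b → NFis a b × Positive b))
mainTheorem6 M (N , M⇒N , N-normal) =
  positive-nf-backward M⇒N (normal-has-positive-nf N-normal)
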